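{- Let $A,B\in\mathbb{N}_m$ with $|A|,|B|\ge2$, and let $\underline{\alpha},\underline{\beta}\in\mathbb{Z}^+_m$. Then (i) $\underline{\alpha}A=\underline{\alpha}B$ if and only if $A=B$; (ii) $\underline{\alpha}A=\underline{\beta}A$ if and only if $\underline{\alpha}=\underline{\beta}$.
   Context: A multiset $M$ of nonnegative integers is described by its multiplicity function $\chi_M$; $|M|=\sum_n\chi_M(n)$ is its number of elements counted with multiplicity. $\mathbb{N}_m$ is the family of multisets $M$ of nonnegative integers with $\chi_M(0)=1$ and $\chi_M(n)<\infty$ for all $n\ge1$. $\mathbb{Z}^+_m$ is the set of finite vectors $\underline{\alpha}=(\alpha_1,\dots,\alpha_s)$ ($s\ge1$ arbitrary) of positive integers with $\alpha_1\le\cdots\le\alpha_s$; two such vectors are equal iff they are equal coordinatewise. For a multiset $A$ and positive integer $k$, $kA=\{ka: a\in A\}$ (with multiplicities), and the sum $A+B$ of multisets is the multiset of all $a+b$ over all pairs (with multiplicity). $\underline{\alpha}A=\alpha_1A+\alpha_2A+\cdots+\alpha_sA$; equivalently, listing $A=\{a_1\le a_2\le\cdots\}$ with multiplicity, the multiplicity of $n$ in $\underline{\alpha}A$ is $R_{A,\underline{\alpha}}(n)=|\{(j_1,\dots,j_s)\in(\mathbb{Z}^+)^s:\sum_i\alpha_ia_{j_i}=n\}|$. Equality of multisets means equality of multiplicity functions. -}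

module Defs where

open import Data.Nat using (ℕ; zero; suc; _+_; _*_; _∸_; _≤_; _<_)
open import Data.Nat.Properties using (_≟_)
open import Data.List using (List; []; _∷_)
open import Data.List.Relation.Unary.All using (All)
open import Data.List.Relation.Unary.Linked using (Linked)
open import Data.Product using (∃-syntax; _×_)
open import Relation.Binary.PropositionalEquality using (_≡_)
open import Relation.Nullary.Decidable using (does)
open import Data.Bool using (if_then_else_)
open import Data.Empty using (⊥)
open import Data.Unit using (⊤)

sumTo : (ℕ → ℕ) → ℕ → ℕ
sumTo f zero    = f zero
sumTo f (suc n) = sumTo f n + f (suc n)

-- A multiset of nonnegative integers, given by its multiplicity function
-- (multiplicities are natural numbers, hence finite), with χ(0) = 1:
-- the family ℕ_m.
record Mset : Set where
  constructor mset
  field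
    χ   : ℕ → ℕ
    χ0  : χ 0 ≡ 1
open Mset public

-- |A| ≥ 2  (|A| = Σ_n χ_A(n), possibly infinite; it is ≥ 2 iff some
-- partial sum is ≥ 2)
CardAtLeast2 : Mset → Set
CardAtLeast2 A = ∃[ n ] 2 ≤ sumTo (χ A) n

_≃_ : (ℕ → ℕ) → (ℕ → ℕ) → Set
f ≃ g = ∀ n → f n ≡ g n

-- multiplicity function of the multiset sum A + B
conv : (ℕ → ℕ) → (ℕ → ℕ) → ℕ → ℕ
conv f g n = sumTo (λ k → f k * g (n ∸ k)) n

-- multiplicity function of the dilate kA = {k a : a ∈ A} (for k ≥ 1,
-- every m with k m = n satisfies m ≤ n)
dil : ℕ → (ℕ → ℕ) → ℕ → ℕ
dil k f n = sumTo (λ m → if does (k * m ≟ n) then f m else 0) n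

δ0 : ℕ → ℕ
δ0 zero    = 1
δ0 (suc _) = 0

-- multiplicity function of α₁A + α₂A + ⋯ + α_sA
-- (the empty sum is {0}, the neutral element of multiset addition;
-- only used with s ≥ 1)
dilSum : List ℕ → (ℕ → ℕ) → ℕ → ℕ
dilSum []       f = δ0
dilSum (a ∷ as) f = conv (dil a f) (dilSum as f)

_·_ : List ℕ → Mset → ℕ → ℕ
α · A = dilSum α (χ A)

NonEmptyList : List ℕ → Set
NonEmptyList []      = ⊥
NonEmptyList (_ ∷ _) = ⊤

record PosVec : Set where
  constructor posvec
  field
    vec      : List ℕ
    nonempty : NonEmptyList vec
    positive : All (λ a → 1 ≤ a) vec
    sorted   : Linked _≤_ vec
open PosVec public

-- Both parts are read off from the bottom of the multisets.
-- (i) With α₁ the least coefficient, the multiplicity of α₁n in αA depends only on the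
-- multiplicities of 0, …, n in A and increases strictly with χ_A(n) (through the
-- representation α₁n + 0 + ⋯ + 0); so χ_A = χ_B follows by strong induction on n.
-- (ii) If a is the least positive element of A, the least positive element of αA is α₁a.
-- Hence αA = βA forces α₁ = β₁; the common summand α₁A is then cancelled by the argument
-- of (i), applied to convolution with α₁A, and one recurses on the tails.
module Submission where

open import Data.Bool using (if_then_else_)
open import Data.Empty using (⊥-elim)
open import Data.List using ([]; _∷_)
open import Data.List.Relation.Unary.All as All using (All; []; _∷_)
open import Data.List.Relation.Unary.Linked as Linked using (Linked)
open import Data.List.Relation.Unary.Linked.Properties using (Linked⇒All)
open import Data.Nat
open import Data.Nat.Induction using (<-rec)
open import Data.Nat.Properties
open import Data.Product using (_×_; _,_; ∃-syntax; proj₂)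
open import Data.Sum using (_⊎_; inj₁; inj₂; [_,_]′)
open import Function.Bundles using (_⇔_; mk⇔)
open import Relation.Nullary using (Dec; ¬_; yes; no; contradiction)
open import Relation.Nullary.Decidable using (does; dec-true)
open import Relation.Binary.PropositionalEquality

open import Defs

sumTo-cong : ∀ {F G : ℕ → ℕ} N → (∀ m → m ≤ N → F m ≡ G m) → sumTo F N ≡ sumTo G N
sumTo-cong zero    F≡G = F≡G 0 z≤n
sumTo-cong (suc N) F≡G =
  cong₂ _+_ (sumTo-cong N (λ m m≤N → F≡G m (m≤n⇒m≤1+n m≤N))) (F≡G (suc N) ≤-refl)

sumTo-mono-≤ : ∀ {F G : ℕ → ℕ} N → (∀ m → F m ≤ G m) → sumTo F N ≤ sumTo G N
sumTo-mono-≤ zero    F≤G = F≤G 0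
sumTo-mono-≤ (suc N) F≤G = +-mono-≤ (sumTo-mono-≤ N F≤G) (F≤G (suc N))

sumTo-mono-< : ∀ {F G : ℕ → ℕ} N {p} → p ≤ N → (∀ m → F m ≤ G m) → F p < G p →
               sumTo F N < sumTo G N
sumTo-mono-< zero    z≤n F≤G Fp<Gp = Fp<Gp
sumTo-mono-< (suc N) p≤N F≤G Fp<Gp with m≤n⇒m<n∨m≡n p≤N
... | inj₁ p<N  = +-mono-<-≤ (sumTo-mono-< N (≤-pred p<N) F≤G Fp<Gp) (F≤G (suc N))
... | inj₂ refl = +-mono-≤-< (sumTo-mono-≤ N F≤G) Fp<Gp

≤-sumTo : ∀ (F : ℕ → ℕ) {N p} → p ≤ N → F p ≤ sumTo F N
≤-sumTo F {zero}  z≤n = ≤-refl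
≤-sumTo F {suc N} p≤N with m≤n⇒m<n∨m≡n p≤N
... | inj₁ p<N  = ≤-trans (≤-sumTo F (≤-pred p<N)) (m≤m+n _ _)
... | inj₂ refl = m≤n+m _ _

sumTo-zero : ∀ {F : ℕ → ℕ} N → (∀ m → m ≤ N → F m ≡ 0) → sumTo F N ≡ 0
sumTo-zero zero    F≡0 = F≡0 0 z≤n
sumTo-zero (suc N) F≡0 =
  cong₂ _+_ (sumTo-zero N (λ m m≤N → F≡0 m (m≤n⇒m≤1+n m≤N))) (F≡0 (suc N) ≤-refl)

conv-mono-≤ : ∀ {F F′ G G′ : ℕ → ℕ} → (∀ m → F m ≤ F′ m) → (∀ m → G m ≤ G′ m) →
              ∀ n → conv F G n ≤ conv F′ G′ n
conv-mono-≤ F≤F′ G≤G′ n = sumTo-mono-≤ n (λ k → *-mono-≤ (F≤F′ k) (G≤G′ (n ∸ k)))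

conv-mono-< : ∀ {F F′ G G′ : ℕ → ℕ} → (∀ m → F m ≤ F′ m) → (∀ m → G m ≤ G′ m) →
              ∀ {n k} → k ≤ n → F k * G (n ∸ k) < F′ k * G′ (n ∸ k) →
              conv F G n < conv F′ G′ n
conv-mono-< F≤F′ G≤G′ {n} k≤n =
  sumTo-mono-< n k≤n (λ i → *-mono-≤ (F≤F′ i) (G≤G′ (n ∸ i)))

conv-local : ∀ {F F′ G G′ : ℕ → ℕ} n → (∀ m → m ≤ n → F m ≡ F′ m) →
             (∀ m → m ≤ n → G m ≡ G′ m) → conv F G n ≡ conv F′ G′ n
conv-local n F≡F′ G≡G′ = sumTo-cong n λ k k≤n →
  cong₂ _*_ (F≡F′ k k≤n) (G≡G′ (n ∸ k) (m∸n≤m n k))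

≤-conv : ∀ (F G : ℕ → ℕ) {n k} → k ≤ n → F k * G (n ∸ k) ≤ conv F G n
≤-conv F G {n} = ≤-sumTo (λ k → F k * G (n ∸ k))

if-does-preserves : ∀ {p} {P : Set p} (R : ℕ → ℕ → Set) (d : Dec P) {x y : ℕ} → R 0 0 →
                    (P → R x y) → R (if does d then x else 0) (if does d then y else 0)
if-does-preserves R (yes p) R00 Rxy = Rxy p
if-does-preserves R (no _)  R00 Rxy = R00

if-does-true : ∀ {p} {P : Set p} (d : Dec P) {x : ℕ} → P → (if does d then x else 0) ≡ x
if-does-true d {x} p = cong (if_then x else 0) (dec-true d p)

dil-0 : ∀ k (f : ℕ → ℕ) → dil k f 0 ≡ f 0
dil-0 k f rewrite *-zeroʳ k = refl

dil-mono-≤ : ∀ k {f g : ℕ → ℕ} → (∀ m → f m ≤ g m) → ∀ n → dil k f n ≤ dil k g n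
dil-mono-≤ k f≤g n = sumTo-mono-≤ n λ m → if-does-preserves _≤_ (k * m ≟ n) z≤n (λ _ → f≤g m)

dil-mono-< : ∀ k .{{_ : NonZero k}} {f g : ℕ → ℕ} → (∀ m → f m ≤ g m) →
             ∀ {n} → f n < g n → dil k f (k * n) < dil k g (k * n)
dil-mono-< k f≤g {n} fn<gn =
  sumTo-mono-< (k * n) (m≤n*m n k)
    (λ m → if-does-preserves _≤_ (k * m ≟ k * n) z≤n (λ _ → f≤g m))
    (subst₂ _<_ (sym (if-does-true (k * n ≟ k * n) refl))
                (sym (if-does-true (k * n ≟ k * n) refl)) fn<gn)

≤-dil : ∀ k .{{_ : NonZero k}} (f : ℕ → ℕ) n → f n ≤ dil k f (k * n)
≤-dil k f n = ≤-trans (≤-reflexive (sym (if-does-true (k * n ≟ k * n) refl)))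
                      (≤-sumTo (λ m → if does (k * m ≟ k * n) then f m else 0) (m≤n*m n k))

dil-local : ∀ {K k} → K ≤ k → ∀ {f g : ℕ → ℕ} {N} → (∀ m → K * m ≤ N → f m ≡ g m) →
            ∀ j → j ≤ N → dil k f j ≡ dil k g j
dil-local {K} {k} K≤k f≡g j j≤N = sumTo-cong j λ m _ →
  if-does-preserves _≡_ (k * m ≟ j) refl λ km≡j →
    f≡g m (≤-trans (*-monoˡ-≤ m K≤k) (≤-trans (≤-reflexive km≡j) j≤N))

dilSum-0 : ∀ α {f : ℕ → ℕ} → f 0 ≡ 1 → dilSum α f 0 ≡ 1
dilSum-0 []      f0 = refl
dilSum-0 (a ∷ α) {f} f0 = cong₂ _*_ (trans (dil-0 a f) f0) (dilSum-0 α f0)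

dilSum-mono-≤ : ∀ α {f g : ℕ → ℕ} → (∀ m → f m ≤ g m) → ∀ n → dilSum α f n ≤ dilSum α g n
dilSum-mono-≤ []      f≤g n = ≤-refl
dilSum-mono-≤ (a ∷ α) f≤g   = conv-mono-≤ (dil-mono-≤ a f≤g) (dilSum-mono-≤ α f≤g)

dilSum-cong : ∀ α {f g : ℕ → ℕ} → f ≃ g → dilSum α f ≃ dilSum α g
dilSum-cong α f≃g n = ≤-antisym (dilSum-mono-≤ α (λ m → ≤-reflexive (f≃g m)) n)
                                (dilSum-mono-≤ α (λ m → ≤-reflexive (sym (f≃g m))) n)

dilSum-local : ∀ {K} α → All (K ≤_) α → ∀ {f g : ℕ → ℕ} {N} →
               (∀ m → K * m ≤ N → f m ≡ g m) → ∀ j → j ≤ N → dilSum α f j ≡ dilSum α g j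
dilSum-local []      []            f≡g j j≤N = refl
dilSum-local (a ∷ α) (K≤a ∷ K≤α) f≡g j j≤N =
  conv-local j (λ m m≤j → dil-local K≤a f≡g m (≤-trans m≤j j≤N))
               (λ m m≤j → dilSum-local α K≤α f≡g m (≤-trans m≤j j≤N))

dilSum-mono-< : ∀ K .{{_ : NonZero K}} α {f g : ℕ → ℕ} → f 0 ≡ 1 → (∀ m → f m ≤ g m) →
                ∀ {n} → f n < g n → dilSum (K ∷ α) f (K * n) < dilSum (K ∷ α) g (K * n)
dilSum-mono-< K α {f} {g} f0 f≤g {n} fn<gn =
  conv-mono-< (dil-mono-≤ K f≤g) (dilSum-mono-≤ α f≤g) {K * n} ≤-refl
    (subst (λ i → dil K f (K * n) * dilSum α f i < dil K g (K * n) * dilSum α g i)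
           (sym (n∸n≡0 (K * n))) lastTerm)
  where
  open ≤-Reasoning
  lastTerm : dil K f (K * n) * dilSum α f 0 < dil K g (K * n) * dilSum α g 0
  lastTerm = begin-strict
    dil K f (K * n) * dilSum α f 0 ≡⟨ cong (dil K f (K * n) *_) (dilSum-0 α f0) ⟩
    dil K f (K * n) * 1            <⟨ *-monoˡ-< 1 (dil-mono-< K f≤g fn<gn) ⟩
    dil K g (K * n) * 1            ≡⟨ cong (dil K g (K * n) *_) (sym (dilSum-0 α f0)) ⟩
    dil K g (K * n) * dilSum α f 0 ≤⟨ *-monoʳ-≤ (dil K g (K * n)) (dilSum-mono-≤ α f≤g 0) ⟩
    dil K g (K * n) * dilSum α g 0 ∎

-- The multiset analogue of a triangular matrix with nonzero diagonal.
record Triangular (T : (ℕ → ℕ) → ℕ → ℕ) (p : ℕ → ℕ) : Set where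
  field
    local  : ∀ {f g : ℕ → ℕ} n → (∀ m → m ≤ n → f m ≡ g m) → T f (p n) ≡ T g (p n)
    mono-< : ∀ {f g : ℕ → ℕ} n → f 0 ≡ 1 → (∀ m → f m ≤ g m) → f n < g n →
             T f (p n) < T g (p n)

_↾_ : (ℕ → ℕ) → ℕ → ℕ → ℕ
(f ↾ n) m = if does (m ≤? n) then f m else 0

↾-agrees : ∀ (f : ℕ → ℕ) {n m} → m ≤ n → (f ↾ n) m ≡ f m
↾-agrees f {n} {m} = if-does-true (m ≤? n)

↾-mono-≤ : ∀ {f g : ℕ → ℕ} {n} → (∀ m → m < n → f m ≡ g m) → f n ≤ g n →
           ∀ m → (f ↾ n) m ≤ (g ↾ n) m
↾-mono-≤ {n = n} f≡g fn≤gn m = if-does-preserves _≤_ (m ≤? n) z≤n λ m≤n →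
  [ (λ m<n → ≤-reflexive (f≡g m m<n)) , (λ { refl → fn≤gn }) ]′ (m≤n⇒m<n∨m≡n m≤n)

module _ {T p} (triangular : Triangular T p) where
  open Triangular triangular

  private
    no-first-jump : ∀ {f g : ℕ → ℕ} → f 0 ≡ 1 → T f ≃ T g →
                    ∀ n → (∀ m → m < n → f m ≡ g m) → ¬ f n < g n
    no-first-jump {f} {g} f0 Tf≃Tg n f≡g fn<gn = <-irrefl (Tf≃Tg (p n)) (begin-strict
      T f (p n)       ≡⟨ local n (λ m m≤n → sym (↾-agrees f m≤n)) ⟩
      T (f ↾ n) (p n) <⟨ mono-< n f0 (↾-mono-≤ f≡g (<⇒≤ fn<gn))
                           (subst₂ _<_ (sym (↾-agrees f ≤-refl)) (sym (↾-agrees g ≤-refl)) fn<gn) ⟩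
      T (g ↾ n) (p n) ≡⟨ local n (λ m m≤n → ↾-agrees g m≤n) ⟩
      T g (p n)       ∎)
      where open ≤-Reasoning

  triangular-injective : ∀ {f g : ℕ → ℕ} → f 0 ≡ 1 → g 0 ≡ 1 → T f ≃ T g → f ≃ g
  triangular-injective {f} {g} f0 g0 Tf≃Tg = <-rec (λ n → f n ≡ g n) λ n f≡g →
    ≤-antisym (≮⇒≥ (no-first-jump g0 (λ i → sym (Tf≃Tg i)) n (λ _ m<n → sym (f≡g m<n))))
              (≮⇒≥ (no-first-jump f0 Tf≃Tg n (λ _ m<n → f≡g m<n)))

conv-triangular : ∀ F → F 0 ≡ 1 → Triangular (conv F) (λ n → n)
conv-triangular F F0 = record
  { local  = λ n → conv-local {F} n (λ _ _ → refl)
  ; mono-< = λ {f} {g} n _ f≤g fn<gn → conv-mono-< {F} (λ _ → ≤-refl) f≤g {n} z≤n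
               (subst (λ c → c * f n < c * g n) (sym F0) (*-monoʳ-< 1 fn<gn))
  }

dilSum-triangular : ∀ K .{{_ : NonZero K}} α → All (K ≤_) α → Triangular (dilSum (K ∷ α)) (K *_)
dilSum-triangular K α K≤α = record
  { local  = λ n f≡g → dilSum-local (K ∷ α) (≤-refl ∷ K≤α)
               (λ m Km≤Kn → f≡g m (*-cancelˡ-≤ K Km≤Kn)) (K * n) ≤-refl
  ; mono-< = λ n f0 f≤g → dilSum-mono-< K α f0 f≤g
  }

conv-injectiveʳ : ∀ F {G H : ℕ → ℕ} → F 0 ≡ 1 → G 0 ≡ 1 → H 0 ≡ 1 →
                  conv F G ≃ conv F H → G ≃ H
conv-injectiveʳ F F0 = triangular-injective (conv-triangular F F0)

sorted⇒head-≤ : ∀ {k ks} → Linked _≤_ (k ∷ ks) → All (k ≤_) ks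
sorted⇒head-≤ sorted = All.tail (Linked⇒All ≤-trans ≤-refl sorted)

NoPositiveElementBelow : (ℕ → ℕ) → ℕ → Set
NoPositiveElementBelow F p = ∀ n → 0 < n → n < p → F n ≡ 0

LeastPositiveElement : (ℕ → ℕ) → ℕ → Set
LeastPositiveElement F p = 0 < p × 0 < F p × NoPositiveElementBelow F p

noPositiveElementBelow-≤ : ∀ {F p q} → q ≤ p → NoPositiveElementBelow F p →
                           NoPositiveElementBelow F q
noPositiveElementBelow-≤ q≤p none n 0<n n<q = none n 0<n (<-≤-trans n<q q≤p)

noPositiveElementBelow-conv : ∀ {F G p} → NoPositiveElementBelow F p → NoPositiveElementBelow G p →
                              NoPositiveElementBelow (conv F G) p
noPositiveElementBelow-conv {F} {G} noneF noneG n 0<n n<p = sumTo-zero n term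
  where
  term : ∀ k → k ≤ n → F k * G (n ∸ k) ≡ 0
  term zero    _   = trans (cong (F 0 *_) (noneG n 0<n n<p)) (*-zeroʳ (F 0))
  term (suc k) k<n = cong (_* G (n ∸ suc k)) (noneF (suc k) z<s (≤-<-trans k<n n<p))

noPositiveElementBelow-dil : ∀ k {f a} → NoPositiveElementBelow f a →
                             NoPositiveElementBelow (dil k f) (k * a)
noPositiveElementBelow-dil k {f} none n 0<n n<ka = sumTo-zero n λ m _ →
  if-does-preserves (λ x _ → x ≡ 0) (k * m ≟ n) {y = 0} refl λ km≡n →
    none m (n≢0⇒n>0 λ { refl → <⇒≢ 0<n (trans (sym (*-zeroʳ k)) km≡n) })
           (*-cancelˡ-< k _ _ (subst (_< k * _) (sym km≡n) n<ka))

noPositiveElementBelow-dilSum : ∀ {K} α → All (K ≤_) α → ∀ {f a} → NoPositiveElementBelow f a →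
                                NoPositiveElementBelow (dilSum α f) (K * a)
noPositiveElementBelow-dilSum []      []          none (suc n) _ _ = refl
noPositiveElementBelow-dilSum (b ∷ α) (K≤b ∷ K≤α) {a = a} none =
  noPositiveElementBelow-conv
    (noPositiveElementBelow-≤ (*-monoˡ-≤ a K≤b) (noPositiveElementBelow-dil b none))
    (noPositiveElementBelow-dilSum α K≤α none)

leastPositiveElement-dilSum : ∀ {f a b bs} → f 0 ≡ 1 → 0 < b → Linked _≤_ (b ∷ bs) →
                              LeastPositiveElement f a →
                              LeastPositiveElement (dilSum (b ∷ bs) f) (b * a)
leastPositiveElement-dilSum {f} {a} {b} {bs} f0 0<b sorted (0<a , 0<fa , none) =
  *-mono-< 0<b 0<a , 0<value ,
  noPositiveElementBelow-dilSum (b ∷ bs) (Linked⇒All ≤-trans ≤-refl sorted) none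
  where
  instance _ = >-nonZero 0<b
  open ≤-Reasoning
  0<value : 0 < dilSum (b ∷ bs) f (b * a)
  0<value = begin-strict
    0                                             <⟨ 0<fa ⟩
    f a                                           ≤⟨ ≤-dil b f a ⟩
    dil b f (b * a)                               ≡⟨ sym (*-identityʳ _) ⟩
    dil b f (b * a) * 1                           ≡⟨ cong (dil b f (b * a) *_) (sym (dilSum-0 bs f0)) ⟩
    dil b f (b * a) * dilSum bs f 0               ≡⟨ cong (λ i → dil b f (b * a) * dilSum bs f i)
                                                           (sym (n∸n≡0 (b * a))) ⟩
    dil b f (b * a) * dilSum bs f (b * a ∸ b * a) ≤⟨ ≤-conv (dil b f) (dilSum bs f) {b * a} ≤-refl ⟩
    dilSum (b ∷ bs) f (b * a)                     ∎

leastPositiveElement-unique : ∀ {F G p q} → F ≃ G → LeastPositiveElement F p →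
                              LeastPositiveElement G q → p ≡ q
leastPositiveElement-unique F≃G (0<p , 0<Fp , noneF) (0<q , 0<Gq , noneG) =
  ≤-antisym (≮⇒≥ λ q<p → <⇒≢ 0<Gq (sym (trans (sym (F≃G _)) (noneF _ 0<q q<p))))
            (≮⇒≥ λ p<q → <⇒≢ 0<Fp (sym (trans (F≃G _) (noneG _ 0<p p<q))))

leastPositiveElement-δ0 : ∀ {F p} → LeastPositiveElement F p → ¬ F ≃ δ0
leastPositiveElement-δ0 {p = suc p} (_ , 0<Fp , _) F≃δ0 = <⇒≢ 0<Fp (sym (F≃δ0 (suc p)))

leastPositiveElement-or-none : ∀ f N → NoPositiveElementBelow f (suc N) ⊎
                                       ∃[ a ] LeastPositiveElement f a
leastPositiveElement-or-none f zero = inj₁ λ { (suc _) _ (s≤s ()) }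
leastPositiveElement-or-none f (suc N) with leastPositiveElement-or-none f N | f (suc N) ≟ 0
... | inj₂ least | _      = inj₂ least
... | inj₁ none  | no  ≢0 = inj₂ (suc N , z<s , n≢0⇒n>0 ≢0 , none)
... | inj₁ none  | yes ≡0 = inj₁ λ n 0<n n<2+N →
  [ none n 0<n , (λ { refl → ≡0 }) ]′ (m≤n⇒m<n∨m≡n (≤-pred n<2+N))

sumTo-noPositiveElementBelow : ∀ {f} N → NoPositiveElementBelow f (suc N) → sumTo f N ≡ f 0
sumTo-noPositiveElementBelow zero    none = refl
sumTo-noPositiveElementBelow (suc N) none = trans
  (cong₂ _+_ (sumTo-noPositiveElementBelow N (noPositiveElementBelow-≤ (n≤1+n _) none))
             (none (suc N) z<s ≤-refl))
  (+-identityʳ _)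

leastPositiveElement-exists : ∀ {f} → f 0 ≡ 1 → ∀ N → 2 ≤ sumTo f N →
                              ∃[ a ] LeastPositiveElement f a
leastPositiveElement-exists f0 N 2≤Σf with leastPositiveElement-or-none _ N
... | inj₂ least = least
... | inj₁ none  =
  contradiction (subst (2 ≤_) (trans (sumTo-noPositiveElementBelow N none) f0) 2≤Σf) λ { (s≤s ()) }

dilSum-injectiveˡ : ∀ {f a} → f 0 ≡ 1 → LeastPositiveElement f a →
                    ∀ {α β} → All (0 <_) α → Linked _≤_ α → All (0 <_) β → Linked _≤_ β →
                    dilSum α f ≃ dilSum β f → α ≡ β
dilSum-injectiveˡ f0 least {[]}     {[]}     _ _ _ _ _ = refl
dilSum-injectiveˡ f0 least {[]}     {c ∷ cs} _ _ (0<c ∷ _) sc αf≃βf = ⊥-elim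
  (leastPositiveElement-δ0 (leastPositiveElement-dilSum f0 0<c sc least) (λ n → sym (αf≃βf n)))
dilSum-injectiveˡ f0 least {b ∷ bs} {[]}     (0<b ∷ _) sb _ _ αf≃βf = ⊥-elim
  (leastPositiveElement-δ0 (leastPositiveElement-dilSum f0 0<b sb least) αf≃βf)
dilSum-injectiveˡ {f} {a} f0 least@(0<a , _) {b ∷ bs} {c ∷ cs} (0<b ∷ 0<bs) sb (0<c ∷ 0<cs) sc αf≃βf
  with refl ← *-cancelʳ-≡ b c a {{>-nonZero 0<a}}
                (leastPositiveElement-unique αf≃βf (leastPositiveElement-dilSum f0 0<b sb least)
                                                   (leastPositiveElement-dilSum f0 0<c sc least))
  = cong (b ∷_) (dilSum-injectiveˡ f0 least 0<bs (Linked.tail sb) 0<cs (Linked.tail sc)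
      (conv-injectiveʳ (dil b f) (trans (dil-0 b f) f0) (dilSum-0 bs f0) (dilSum-0 cs f0) αf≃βf))

theorem1p6 : (A B : Mset) → CardAtLeast2 A → CardAtLeast2 B → (α β : PosVec) →
    (((vec α · A) ≃ (vec α · B)) ⇔ (χ A ≃ χ B))
    × (((vec α · A) ≃ (vec β · A)) ⇔ (vec α ≡ vec β))
theorem1p6 A B (N , 2≤|A|) _ α@(posvec (k ∷ ks) _ (0<k ∷ _) sα) β =
  mk⇔ (triangular-injective (dilSum-triangular k {{>-nonZero 0<k}} ks (sorted⇒head-≤ sα))
                            (χ0 A) (χ0 B))
      (dilSum-cong (k ∷ ks))
  ,
  mk⇔ (dilSum-injectiveˡ (χ0 A) (proj₂ (leastPositiveElement-exists (χ0 A) N 2≤|A|))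
                         (positive α) (sorted α) (positive β) (sorted β))
      (λ { refl → λ _ → refl })
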